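{- Let $(W,S)$ be a finite Coxeter system, $i\ne j$, $m:=m_{ij}$, $\mathsf Q,\mathsf Q'\in S^*$, $\pi\in W$. Let $\widetilde\Delta_1$ be the subcomplex of $\Delta_1$ consisting of all faces of $\Delta_1$ that contain no internal vertex $\mathsf f_l$ ($2\le l\le m-1$) and do not contain $F=\{\mathsf f_1,\mathsf f_m\}$; let $\widetilde\Delta_2$ be the subcomplex of $\Delta_2$ of all faces containing no internal vertex $\mathsf g_l$ ($2\le l\le m-1$) and not containing $G=\{\mathsf g_1,\mathsf g_m\}$. Then there is an isomorphism of simplicial complexes $\phi:\widetilde\Delta_1\to\widetilde\Delta_2$ which sends every position lying in the factor $\mathsf Q$ or $\mathsf Q'$ to the corresponding position, sends $\mathsf f_1$ to $\mathsf g_m$ and sends $\mathsf f_m$ to $\mathsf g_1$.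
   Context: $(W,S)$ is a finite Coxeter system, $m_{ij}$ the order of $s_is_j$; $S^*$ the set of words in the alphabet $S$ (letter $\mathsf s$ for $s$); a word is a reduced expression of the product of its letters if its length equals the Coxeter length of that product; $\mathsf u$ contains $\mathsf v$ if $\mathsf v$ is obtained from $\mathsf u$ by deleting letters. For $\mathsf U\in S^*$, $\rho\in W$, the subword complex $\Delta(\mathsf U;\rho)$ has vertex set the positions of $\mathsf U$ (distinct positions are distinct vertices) and faces the sets $I$ of positions such that the letters at positions outside $I$ form a word containing a reduced expression of $\rho$. $\mathsf w^0_{i,j}=\mathsf s_i\mathsf s_j\mathsf s_i\cdots$ and $\mathsf w^0_{j,i}=\mathsf s_j\mathsf s_i\mathsf s_j\cdots$ are the alternating words of length $m$; $\mathsf Q^0_1=\mathsf Q\mathsf w^0_{i,j}\mathsf Q'$, $\mathsf Q^0_2=\mathsf Q\mathsf w^0_{j,i}\mathsf Q'$ (they differ by one braid move); $\mathsf f_l$ (resp. $\mathsf g_l$), $1\le l\le m$, is the position in $\mathsf Q^0_1$ (resp. $\mathsf Q^0_2$) of the $l$-th letter of the factor $\mathsf w^0_{i,j}$ (resp. $\mathsf w^0_{j,i}$); these are called internal when $2\le l\le m-1$. $\Delta_1=\Delta(\mathsf Q^0_1;\pi)$, $\Delta_2=\Delta(\mathsf Q^0_2;\pi)$. -}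

module Defs where

open import Data.Nat using (ℕ; zero; suc; _≤_; _<_)
open import Data.Fin using (Fin; zero; suc; toℕ)
open import Data.Fin.Subset using (Subset; _∈_; _∉_)
open import Data.Vec using (Vec; []; _∷_)
open import Data.Bool using (Bool; true; false)
open import Data.List using (List; []; _∷_; _++_; length; concat; replicate)
open import Data.List.Relation.Binary.Sublist.Propositional using (_⊆_)
open import Data.List.Membership.Propositional using () renaming (_∈_ to _∈L_)
open import Data.Product using (Σ; ∃; _×_; _,_)
open import Relation.Binary.PropositionalEquality using (_≡_; _≢_)
open import Relation.Nullary using (¬_)

record CoxeterMatrix (n : ℕ) : Set where
  field
    m     : Fin n → Fin n → ℕ
    m-diag : ∀ i → m i i ≡ 1
    m-sym  : ∀ i j → m i j ≡ m j i
    m-off  : ∀ i j → i ≢ j → 2 ≤ m i j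

module Coxeter {n : ℕ} (M : CoxeterMatrix n) where
  open CoxeterMatrix M

  Word : Set
  Word = List (Fin n)

  powPair : Fin n → Fin n → ℕ → Word
  powPair i j k = concat (replicate k (i ∷ j ∷ []))

  data _∼_ : Word → Word → Set where
    rel    : ∀ i j (u v : Word) → (u ++ powPair i j (m i j) ++ v) ∼ (u ++ v)
    ∼-refl  : ∀ {u} → u ∼ u
    ∼-sym   : ∀ {u v} → u ∼ v → v ∼ u
    ∼-trans : ∀ {u v w} → u ∼ v → v ∼ w → u ∼ w

  FiniteW : Set
  FiniteW = Σ (List Word) λ L → ∀ w → ∃ λ v → v ∈L L × w ∼ v

  ReducedExpr : Word → Word → Set
  ReducedExpr r ρ = r ∼ ρ × (∀ v → v ∼ ρ → length r ≤ length v)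

  ContainsReduced : Word → Word → Set
  ContainsReduced u ρ = ∃ λ r → r ⊆ u × ReducedExpr r ρ

  complementWord : (U : Word) → Subset (length U) → Word
  complementWord []      []      = []
  complementWord (x ∷ U) (true  ∷ I) = complementWord U I
  complementWord (x ∷ U) (false ∷ I) = x ∷ complementWord U I

  SubwordFace : (U : Word) → Word → Subset (length U) → Set
  SubwordFace U ρ I = ContainsReduced (complementWord U I) ρ

  alt : Fin n → Fin n → ℕ → Word
  alt i j zero    = []
  alt i j (suc k) = i ∷ alt j i k

posL : ∀ {A : Set} (Q R : List A) → Fin (length Q) → Fin (length (Q ++ R))
posL (x ∷ Q) R zero    = zero
posL (x ∷ Q) R (suc k) = suc (posL Q R k)

posR : ∀ {A : Set} (Q R : List A) → Fin (length R) → Fin (length (Q ++ R))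
posR []      R k = k
posR (x ∷ Q) R k = suc (posR Q R k)

posQ : ∀ {A : Set} (Q w Q' : List A) → Fin (length Q) → Fin (length (Q ++ (w ++ Q')))
posQ Q w Q' p = posL Q (w ++ Q') p

posMid : ∀ {A : Set} (Q w Q' : List A) → Fin (length w) → Fin (length (Q ++ (w ++ Q')))
posMid Q w Q' l = posR Q (w ++ Q') (posL w Q' l)

posQ' : ∀ {A : Set} (Q w Q' : List A) → Fin (length Q') → Fin (length (Q ++ (w ++ Q')))
posQ' Q w Q' p = posR Q (w ++ Q') (posR w Q' p)

-- the restricted complex: faces of Δ(Q w Q'; π) containing no internal
-- vertex of the middle factor (0-based index l with 1 ≤ l ≤ m-2) and not
-- containing both its first (l = 0) and last (l = m-1) vertex.

module _ {n : ℕ} (M : CoxeterMatrix n) where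
  open Coxeter M

  TildeFace : (Q w Q' : Word) (mm : ℕ) (π : Word)
            → Subset (length (Q ++ (w ++ Q'))) → Set
  TildeFace Q w Q' mm π I =
      SubwordFace (Q ++ (w ++ Q')) π I
    × (∀ (l : Fin (length w)) → 0 < toℕ l → suc (toℕ l) < mm → posMid Q w Q' l ∉ I)
    × ¬ (∃ λ (l : Fin (length w)) → ∃ λ (l' : Fin (length w)) →
           toℕ l ≡ 0 × suc (toℕ l') ≡ mm × posMid Q w Q' l ∈ I × posMid Q w Q' l' ∈ I)

Vertex : ∀ {a} → (Subset a → Set) → Fin a → Set
Vertex {a} K v = ∃ λ (I : Subset a) → K I × v ∈ I

IsImage : ∀ {a b} → (Fin a → Fin b) → Subset a → Subset b → Set
IsImage {a} f I J = ∀ y → (y ∈ J → ∃ λ x → x ∈ I × f x ≡ y) × (∀ x → x ∈ I → f x ∈ J)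

IsSimplicialIso : ∀ {a b} (K₁ : Subset a → Set) (K₂ : Subset b → Set) → (Fin a → Fin b) → Set
IsSimplicialIso {a} {b} K₁ K₂ f = ∃ λ (g : Fin b → Fin a) →
    (∀ v → Vertex K₁ v → Vertex K₂ (f v) × g (f v) ≡ v)
  × (∀ v → Vertex K₂ v → Vertex K₁ (g v) × f (g v) ≡ v)
  × (∀ I J → K₁ I → IsImage f I J → K₂ J)
  × (∀ J I → K₂ J → IsImage g J I → K₁ I)

module Submission where

-- A face of Δ̃₁ meets the braid factor w₁ = s_i s_j ⋯ in at most one end, so its complement contains
-- w₁, w₁ without its first letter, or w₁ without its last letter.  Dropping the first letter of w₁
-- gives w₂ without its last letter and vice versa, so exchanging the ends (f₁ ↦ g_m, f_m ↦ g₁) and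
-- fixing the positions in Q and Q' maps faces that contain an end to faces.
-- For faces avoiding the factor, every subword r of w₁ is equivalent to a subword of w₂ that is not
-- longer: r = w₁ by the braid relation, and otherwise cancelling squares turns r into an alternating
-- word of length < m, which is a subword of w₂.  So reduced expressions of π survive, and by symmetry
-- the vertex map is an isomorphism of the two complexes.

open import Defs
open import Data.Fin using (Fin; zero; suc; toℕ; cast)
open import Data.Fin.Properties using (cast-involutive; toℕ<n; toℕ-injective)
open import Data.Bool using (Bool; true; false)
open import Data.Fin.Subset using (Subset; _∈_; _∉_) renaming (⊥ to ∅)
open import Data.Vec using (Vec; []; _∷_; lookup; tabulate)
open import Data.Vec.Properties
  using (tabulate∘lookup; tabulate-cong; lookup∘tabulate; []=⇒lookup; lookup⇒[]=; lookup-replicate)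
open import Data.Bool.Properties using (⇔→≡; not-¬)
open import Function.Bundles using (mk⇔)
open import Function using (_∘_)
open import Data.Empty using (⊥-elim)
open import Data.List using (List; []; _∷_; _++_; length; reverse; [_])
open import Data.List.Properties using (++-assoc; ++-identityʳ; length-++; unfold-reverse)
open import Data.List.Relation.Binary.Equality.Propositional using (≋⇒≡)
open import Data.List.Relation.Binary.Sublist.Propositional using (_⊆_; []; _∷_; _∷ʳ_; ⊆-refl)
open import Data.List.Relation.Binary.Sublist.Propositional.Properties
  using (length-mono-≤; to-≋; ++⁺; All-resp-⊆; []⊆-universal)
open import Data.List.Relation.Unary.All using (All; []; _∷_)
import Data.List.Relation.Unary.All as All
open import Data.Nat using (ℕ; zero; suc; _+_; _≤_; _<_; z≤n; s≤s; _≤?_)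
open import Data.Nat.Properties
  using (≤-trans; ≤-antisym; ≤-refl; ≤-reflexive; n≤1+n; ≰⇒>; +-monoˡ-≤; +-identityʳ; suc-injective; <-irrefl)
open import Data.Product using (∃; ∃₂; _×_; _,_; proj₁; proj₂)
import Data.Product as Product
open import Data.Sum using (_⊎_; inj₁; inj₂)
import Data.Sum as Sum
open import Relation.Binary.Bundles using (Setoid)
open import Relation.Nullary using (¬_; yes; no)
open import Relation.Binary.PropositionalEquality hiding ([_])

⊆-++-split : ∀ {A : Set} (a : List A) {b r : List A} → r ⊆ a ++ b →
             ∃₂ λ r₁ r₂ → r ≡ r₁ ++ r₂ × r₁ ⊆ a × r₂ ⊆ b
⊆-++-split []      r⊆b = [] , _ , refl , [] , r⊆b
⊆-++-split (x ∷ a) (.x ∷ʳ r⊆) with ⊆-++-split a r⊆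
... | r₁ , r₂ , refl , r₁⊆a , r₂⊆b = r₁ , r₂ , refl , x ∷ʳ r₁⊆a , r₂⊆b
⊆-++-split (x ∷ a) (refl ∷ r⊆) with ⊆-++-split a r⊆
... | r₁ , r₂ , refl , r₁⊆a , r₂⊆b = x ∷ r₁ , r₂ , refl , refl ∷ r₁⊆a , r₂⊆b

⊆∧length≥⇒≡ : ∀ {A : Set} {xs ys : List A} → xs ⊆ ys → length ys ≤ length xs → xs ≡ ys
⊆∧length≥⇒≡ xs⊆ys ys≤xs = ≋⇒≡ (to-≋ (≤-antisym (length-mono-≤ xs⊆ys) ys≤xs) xs⊆ys)

module CoxeterWords {n : ℕ} (M : CoxeterMatrix n) where
  open CoxeterMatrix M
  open Coxeter M

  ∼-setoid : Setoid _ _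
  ∼-setoid = record { Carrier = Word ; _≈_ = _∼_
                    ; isEquivalence = record { refl = ∼-refl ; sym = ∼-sym ; trans = ∼-trans } }

  ++-congˡ : ∀ u {v v'} → v ∼ v' → (u ++ v) ∼ (u ++ v')
  ++-congˡ u (rel i j p v) = subst₂ _∼_ (++-assoc u p _) (++-assoc u p v) (rel i j (u ++ p) v)
  ++-congˡ u ∼-refl          = ∼-refl
  ++-congˡ u (∼-sym h)       = ∼-sym (++-congˡ u h)
  ++-congˡ u (∼-trans h h')  = ∼-trans (++-congˡ u h) (++-congˡ u h')

  ++-congʳ : ∀ u {v v'} → v ∼ v' → (v ++ u) ∼ (v' ++ u)
  ++-congʳ u (rel i j p v) = subst₂ _∼_ assoc (sym (++-assoc p v u)) (rel i j p (v ++ u))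
    where
    rp = powPair i j (m i j)
    assoc : p ++ (rp ++ (v ++ u)) ≡ (p ++ (rp ++ v)) ++ u
    assoc = sym (trans (++-assoc p _ u) (cong (p ++_) (++-assoc rp v u)))
  ++-congʳ u ∼-refl         = ∼-refl
  ++-congʳ u (∼-sym h)      = ∼-sym (++-congʳ u h)
  ++-congʳ u (∼-trans h h') = ∼-trans (++-congʳ u h) (++-congʳ u h')

  square-cancel : ∀ s v → (s ∷ s ∷ v) ∼ v
  square-cancel s v = subst (λ k → (powPair s s k ++ v) ∼ v) (m-diag s) (rel s s [] v)

  reverse-cancel : ∀ v → (reverse v ++ v) ∼ []
  reverse-cancel []      = ∼-refl
  reverse-cancel (s ∷ v) = begin
    reverse (s ∷ v) ++ s ∷ v       ≡⟨ cong (_++ s ∷ v) (unfold-reverse s v) ⟩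
    (reverse v ++ [ s ]) ++ s ∷ v  ≡⟨ ++-assoc (reverse v) [ s ] (s ∷ v) ⟩
    reverse v ++ s ∷ s ∷ v         ≈⟨ ++-congˡ (reverse v) (square-cancel s v) ⟩
    reverse v ++ v                 ≈⟨ reverse-cancel v ⟩
    []                             ∎
    where open import Relation.Binary.Reasoning.Setoid ∼-setoid

  powPair-snoc : ∀ a b k → powPair b a k ++ [ b ] ≡ b ∷ powPair a b k
  powPair-snoc a b zero    = refl
  powPair-snoc a b (suc k) = cong (λ v → b ∷ a ∷ v) (powPair-snoc a b k)

  alt-++-reverse-alt : ∀ a b k → alt a b k ++ reverse (alt b a k) ≡ powPair a b k
  alt-++-reverse-alt a b zero    = refl
  alt-++-reverse-alt a b (suc k) = cong (a ∷_) (begin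
      alt b a k ++ reverse (b ∷ alt a b k)          ≡⟨ cong (alt b a k ++_) (unfold-reverse b (alt a b k)) ⟩
      alt b a k ++ (reverse (alt a b k) ++ [ b ])   ≡⟨ ++-assoc (alt b a k) _ _ ⟨
      (alt b a k ++ reverse (alt a b k)) ++ [ b ]   ≡⟨ cong (_++ [ b ]) (alt-++-reverse-alt b a k) ⟩
      powPair b a k ++ [ b ]                        ≡⟨ powPair-snoc a b k ⟩
      b ∷ powPair a b k                             ∎)
    where open ≡-Reasoning

  -- The defining relation for (s_a s_b)^m is alt a b m ++ reverse (alt b a m) ∼ [], and reverse v inverts v.
  braid : ∀ a b → alt a b (m a b) ∼ alt b a (m a b)
  braid a b = begin
    w                               ≡⟨ ++-identityʳ w ⟨
    w ++ []                         ≈⟨ ++-congˡ w (reverse-cancel w') ⟨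
    w ++ (reverse w' ++ w')         ≡⟨ ++-assoc w (reverse w') w' ⟨
    (w ++ reverse w') ++ w'         ≡⟨ cong (_++ w') (alt-++-reverse-alt a b (m a b)) ⟩
    powPair a b (m a b) ++ w'       ≈⟨ rel a b [] w' ⟩
    w'                              ∎
    where
    open import Relation.Binary.Reasoning.Setoid ∼-setoid
    w  = alt a b (m a b)
    w' = alt b a (m a b)

  length-alt : ∀ a b k → length (alt a b k) ≡ k
  length-alt a b zero    = refl
  length-alt a b (suc k) = cong suc (length-alt b a k)

  lastLetter : Fin n → Fin n → ℕ → Fin n
  lastLetter a b zero    = a
  lastLetter a b (suc k) = lastLetter b a k

  alt-snoc : ∀ a b k → alt a b (suc k) ≡ alt a b k ++ [ lastLetter a b k ]
  alt-snoc a b zero    = refl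
  alt-snoc a b (suc k) = cong (a ∷_) (alt-snoc b a k)

  alt-⊆ : ∀ a b {c k} → c ≤ k → alt a b c ⊆ alt a b k
  alt-⊆ a b {zero}  {k}     _         = []⊆-universal (alt a b k)
  alt-⊆ a b {suc c} {suc k} (s≤s c≤k) = refl ∷ alt-⊆ b a c≤k

  Letter : Fin n → Fin n → Fin n → Set
  Letter a b s = s ≡ a ⊎ s ≡ b

  alt-letters : ∀ a b k → All (Letter a b) (alt a b k)
  alt-letters a b zero    = []
  alt-letters a b (suc k) = inj₁ refl ∷ All.map Sum.swap (alt-letters b a k)

  AlternatingForm : Fin n → Fin n → Word → ℕ → Set
  AlternatingForm a b r c = r ∼ alt a b c ⊎ r ∼ alt b a c

  cons-alternatingForm : ∀ {a b s} c → Letter a b s →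
    ∃ λ c' → c' ≤ suc c × AlternatingForm a b (s ∷ alt a b c) c'
  cons-alternatingForm zero    (inj₁ refl) = 1 , ≤-refl , inj₁ ∼-refl
  cons-alternatingForm (suc c) (inj₁ refl) = c , ≤-trans (n≤1+n c) (n≤1+n (suc c)) , inj₂ (square-cancel _ _)
  cons-alternatingForm c       (inj₂ refl) = suc c , ≤-refl , inj₂ ∼-refl

  prepend : ∀ {s r v v'} → r ∼ v → (s ∷ v) ∼ v' → (s ∷ r) ∼ v'
  prepend {s} r∼v = ∼-trans (++-congˡ [ s ] r∼v)

  alternatingForm : ∀ {a b} r → All (Letter a b) r → ∃ λ c → c ≤ length r × AlternatingForm a b r c
  alternatingForm []      []        = 0 , z≤n , inj₁ ∼-refl
  alternatingForm (s ∷ r) (hs ∷ hr) with alternatingForm r hr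
  ... | c , c≤r , inj₁ r∼ with cons-alternatingForm c hs
  ...   | c' , c'≤ , form = c' , ≤-trans c'≤ (s≤s c≤r) , Sum.map (prepend r∼) (prepend r∼) form
  alternatingForm (s ∷ r) (hs ∷ hr) | c , c≤r , inj₂ r∼ with cons-alternatingForm c (Sum.swap hs)
  ...   | c' , c'≤ , form = c' , ≤-trans c'≤ (s≤s c≤r) , Sum.swap (Sum.map (prepend r∼) (prepend r∼) form)

  SubwordsCovered : Word → Word → Set
  SubwordsCovered w w' = ∀ r → r ⊆ w → ∃ λ r' → r' ⊆ w' × r' ∼ r × length r' ≤ length r

  alt-⊆-alt : ∀ a b {c k} → c < k → alt a b c ⊆ alt b a k
  alt-⊆-alt a b {k = suc k} (s≤s c≤k) = b ∷ʳ alt-⊆ a b c≤k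

  alt-subwordsCovered : ∀ a b k → alt a b k ∼ alt b a k → SubwordsCovered (alt a b k) (alt b a k)
  alt-subwordsCovered a b k braid-ab r r⊆ with k ≤? length r
  ... | yes k≤r = alt b a k , ⊆-refl , ∼-sym (subst (_∼ alt b a k) (sym r≡alt) braid-ab) ,
                  ≤-trans (≤-reflexive (length-alt b a k)) k≤r
    where r≡alt = ⊆∧length≥⇒≡ r⊆ (≤-trans (≤-reflexive (length-alt a b k)) k≤r)
  ... | no k≰r with alternatingForm r (All-resp-⊆ r⊆ (alt-letters a b k))
  ...   | c , c≤r , inj₁ r∼ = alt a b c , alt-⊆-alt a b (≤-trans (s≤s c≤r) (≰⇒> k≰r)) , ∼-sym r∼ ,
                              ≤-trans (≤-reflexive (length-alt a b c)) c≤r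
  ...   | c , c≤r , inj₂ r∼ = alt b a c , alt-⊆ b a (≤-trans c≤r (≤-trans (n≤1+n _) (≰⇒> k≰r))) , ∼-sym r∼ ,
                              ≤-trans (≤-reflexive (length-alt b a c)) c≤r

  length-++-middle-≤ : ∀ (a : Word) {b b'} c → length b ≤ length b' →
                       length (a ++ (b ++ c)) ≤ length (a ++ (b' ++ c))
  length-++-middle-≤ []      {b} {b'} c b≤b' =
    subst₂ _≤_ (sym (length-++ b)) (sym (length-++ b')) (+-monoˡ-≤ (length c) b≤b')
  length-++-middle-≤ (s ∷ a) c b≤b' = s≤s (length-++-middle-≤ a c b≤b')

  containsReduced-replace : ∀ {w w'} → SubwordsCovered w w' → ∀ A B {π} →
    ContainsReduced (A ++ (w ++ B)) π → ContainsReduced (A ++ (w' ++ B)) π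
  containsReduced-replace {w} cover A B (r , r⊆ , r∼π , r-min) with ⊆-++-split A r⊆
  ... | r₁ , _ , refl , r₁⊆A , rest⊆ with ⊆-++-split w rest⊆
  ...   | r₂ , r₃ , refl , r₂⊆w , r₃⊆B with cover r₂ r₂⊆w
  ...     | r₂' , r₂'⊆w' , r₂'∼r₂ , r₂'≤r₂ =
    r₁ ++ (r₂' ++ r₃) , ++⁺ r₁⊆A (++⁺ r₂'⊆w' r₃⊆B) ,
    ∼-trans (++-congˡ r₁ (++-congʳ r₃ r₂'∼r₂)) r∼π ,
    λ v v∼π → ≤-trans (length-++-middle-≤ r₁ r₃ r₂'≤r₂) (r-min v v∼π)

module Concatenation {A : Set} where

  splitPos : (Q R : List A) → Fin (length (Q ++ R)) → Fin (length Q) ⊎ Fin (length R)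
  splitPos []      R k       = inj₂ k
  splitPos (x ∷ Q) R zero    = inj₁ zero
  splitPos (x ∷ Q) R (suc k) = Sum.map₁ suc (splitPos Q R k)

  splitPos-posL : ∀ (Q R : List A) p → splitPos Q R (posL Q R p) ≡ inj₁ p
  splitPos-posL (x ∷ Q) R zero    = refl
  splitPos-posL (x ∷ Q) R (suc p) = cong (Sum.map₁ suc) (splitPos-posL Q R p)

  splitPos-posR : ∀ (Q R : List A) k → splitPos Q R (posR Q R k) ≡ inj₂ k
  splitPos-posR []      R k = refl
  splitPos-posR (x ∷ Q) R k = cong (Sum.map₁ suc) (splitPos-posR Q R k)

  data ConcatView (Q R : List A) : Fin (length (Q ++ R)) → Set where
    left  : ∀ p → ConcatView Q R (posL Q R p)
    right : ∀ k → ConcatView Q R (posR Q R k)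

  concatView : ∀ (Q R : List A) k → ConcatView Q R k
  concatView []      R k       = right k
  concatView (x ∷ Q) R zero    = left zero
  concatView (x ∷ Q) R (suc k) with concatView Q R k
  ... | left p  = left (suc p)
  ... | right k = right k

  toℕ-posL : ∀ (Q R : List A) p → toℕ (posL Q R p) ≡ toℕ p
  toℕ-posL (x ∷ Q) R zero    = refl
  toℕ-posL (x ∷ Q) R (suc p) = cong suc (toℕ-posL Q R p)

  toℕ-posR : ∀ (Q R : List A) k → toℕ (posR Q R k) ≡ length Q + toℕ k
  toℕ-posR []      R k = refl
  toℕ-posR (x ∷ Q) R k = cong suc (toℕ-posR Q R k)

  join : (Q R : List A) → Subset (length Q) → Subset (length R) → Subset (length (Q ++ R))
  join []      R []      J = J
  join (x ∷ Q) R (b ∷ I) J = b ∷ join Q R I J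

  lookup-join-posL : ∀ (Q R : List A) I J p → lookup (join Q R I J) (posL Q R p) ≡ lookup I p
  lookup-join-posL (x ∷ Q) R (b ∷ I) J zero    = refl
  lookup-join-posL (x ∷ Q) R (b ∷ I) J (suc p) = lookup-join-posL Q R I J p

  lookup-join-posR : ∀ (Q R : List A) I J k → lookup (join Q R I J) (posR Q R k) ≡ lookup J k
  lookup-join-posR []      R []      J k = refl
  lookup-join-posR (x ∷ Q) R (b ∷ I) J k = lookup-join-posR Q R I J k

data Position (q k q' : ℕ) : Set where
  inQ   : Fin q → Position q k q'
  first : Position q k q'
  inner : Fin k → Position q k q'
  last  : Position q k q'
  inQ'  : Fin q' → Position q k q'

swapEnds : ∀ {q k k' q'} → .(k ≡ k') → Position q k q' → Position q k' q'
swapEnds eq (inQ p)   = inQ p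
swapEnds eq first     = last
swapEnds eq (inner p) = inner (cast eq p)
swapEnds eq last      = first
swapEnds eq (inQ' p)  = inQ' p

swapEnds-involutive : ∀ {q k k' q'} .(eq : k ≡ k') .(eq' : k' ≡ k) (t : Position q k q') →
                      swapEnds eq' (swapEnds eq t) ≡ t
swapEnds-involutive eq eq' (inQ p)   = refl
swapEnds-involutive eq eq' first     = refl
swapEnds-involutive eq eq' (inner p) = cong inner (cast-involutive eq' eq p)
swapEnds-involutive eq eq' last      = refl
swapEnds-involutive eq eq' (inQ' p)  = refl

entry : ∀ {q k q'} → Subset q → Bool → Subset k → Bool → Subset q' → Position q k q' → Bool
entry IQ b Iu e IQ' (inQ p)   = lookup IQ p
entry IQ b Iu e IQ' first     = b
entry IQ b Iu e IQ' (inner p) = lookup Iu p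
entry IQ b Iu e IQ' last      = e
entry IQ b Iu e IQ' (inQ' p)  = lookup IQ' p

entry-swapEnds : ∀ {q k k' q'} .(eq : k ≡ k') (IQ : Subset q) b e (IQ' : Subset q') t →
                 entry IQ b ∅ e IQ' (swapEnds eq t) ≡ entry IQ e ∅ b IQ' t
entry-swapEnds eq IQ b e IQ' (inQ p)   = refl
entry-swapEnds eq IQ b e IQ' first     = refl
entry-swapEnds eq IQ b e IQ' (inner p) =
  trans (lookup-replicate (cast eq p) false) (sym (lookup-replicate p false))
entry-swapEnds eq IQ b e IQ' last      = refl
entry-swapEnds eq IQ b e IQ' (inQ' p)  = refl

≗-lookup⇒≡ : ∀ {A : Set} {k} {v v' : Vec A k} → (∀ i → lookup v i ≡ lookup v' i) → v ≡ v'
≗-lookup⇒≡ {v = v} {v'} eq =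
  trans (sym (tabulate∘lookup v)) (trans (tabulate-cong eq) (tabulate∘lookup v'))

module Layout {A : Set} (Q Q' : List A) (x : A) (u : List A) (y : A) where
  open Concatenation

  w : List A
  w = x ∷ (u ++ [ y ])

  Pos : Set
  Pos = Position (length Q) (length u) (length Q')

  N : ℕ
  N = length (Q ++ (w ++ Q'))

  lastIndex : Fin (length w)
  lastIndex = suc (posR u [ y ] zero)

  encode : Pos → Fin N
  encode (inQ p)   = posQ Q w Q' p
  encode first     = posMid Q w Q' zero
  encode (inner p) = posMid Q w Q' (suc (posL u [ y ] p))
  encode last      = posMid Q w Q' lastIndex
  encode (inQ' p)  = posQ' Q w Q' p

  decodeMiddle : Fin (length w) → Pos
  decodeMiddle zero    = first
  decodeMiddle (suc l) = Sum.[ inner , (λ _ → last) ] (splitPos u [ y ] l)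

  decode : Fin N → Pos
  decode k = Sum.[ inQ , Sum.[ decodeMiddle , inQ' ] ∘ splitPos w Q' ] (splitPos Q (w ++ Q') k)

  decode-encode : ∀ t → decode (encode t) ≡ t
  decode-encode (inQ p) rewrite splitPos-posL Q (w ++ Q') p = refl
  decode-encode first
    rewrite splitPos-posR Q (w ++ Q') (posL w Q' zero) | splitPos-posL w Q' zero = refl
  decode-encode (inner p)
    rewrite splitPos-posR Q (w ++ Q') (posL w Q' (suc (posL u [ y ] p)))
          | splitPos-posL w Q' (suc (posL u [ y ] p))
          | splitPos-posL u [ y ] p = refl
  decode-encode last
    rewrite splitPos-posR Q (w ++ Q') (posL w Q' lastIndex)
          | splitPos-posL w Q' lastIndex
          | splitPos-posR u [ y ] zero = refl
  decode-encode (inQ' p)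
    rewrite splitPos-posR Q (w ++ Q') (posR w Q' p) | splitPos-posR w Q' p = refl

  data MiddleView : Fin (length w) → Set where
    at-first : MiddleView zero
    at-inner : ∀ p → MiddleView (suc (posL u [ y ] p))
    at-last  : MiddleView lastIndex

  middleView : ∀ l → MiddleView l
  middleView zero = at-first
  middleView (suc l) with concatView u [ y ] l
  ... | left p     = at-inner p
  ... | right zero = at-last

  data PositionView : Fin N → Set where
    at : ∀ t → PositionView (encode t)

  positionView : ∀ k → PositionView k
  positionView k with concatView Q (w ++ Q') k
  ... | left p = at (inQ p)
  ... | right k with concatView w Q' k
  ...   | right p = at (inQ' p)
  ...   | left l with middleView l
  ...     | at-first   = at first
  ...     | at-inner p = at (inner p)
  ...     | at-last    = at last

  encode-decode : ∀ k → encode (decode k) ≡ k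
  encode-decode k with positionView k
  ... | at t = cong encode (decode-encode t)

  ≗-encode⇒≡ : {I J : Subset N} → (∀ t → lookup I (encode t) ≡ lookup J (encode t)) → I ≡ J
  ≗-encode⇒≡ {I} {J} eq =
    ≗-lookup⇒≡ λ k → subst (λ k → lookup I k ≡ lookup J k) (encode-decode k) (eq (decode k))

  assemble : Subset (length Q) → Bool → Subset (length u) → Bool → Subset (length Q') → Subset N
  assemble IQ b Iu e IQ' = join Q (w ++ Q') IQ (b ∷ join (u ++ [ y ]) Q' (join u [ y ] Iu (e ∷ [])) IQ')

  lookup-assemble : ∀ IQ b Iu e IQ' t → lookup (assemble IQ b Iu e IQ') (encode t) ≡ entry IQ b Iu e IQ' t
  lookup-assemble IQ b Iu e IQ' (inQ p) = lookup-join-posL Q (w ++ Q') IQ _ p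
  lookup-assemble IQ b Iu e IQ' first   = lookup-join-posR Q (w ++ Q') IQ _ zero
  lookup-assemble IQ b Iu e IQ' (inner p) = begin
    lookup (assemble IQ b Iu e IQ') (encode (inner p))                 ≡⟨ lookup-join-posR Q (w ++ Q') IQ _ _ ⟩
    lookup (join (u ++ [ y ]) Q' Iw IQ') (posL (u ++ [ y ]) Q' _)     ≡⟨ lookup-join-posL (u ++ [ y ]) Q' _ IQ' _ ⟩
    lookup Iw (posL u [ y ] p)                                          ≡⟨ lookup-join-posL u [ y ] Iu _ p ⟩
    lookup Iu p                                                         ∎
    where open ≡-Reasoning
          Iw = join u [ y ] Iu (e ∷ [])
  lookup-assemble IQ b Iu e IQ' last = begin
    lookup (assemble IQ b Iu e IQ') (encode last)                      ≡⟨ lookup-join-posR Q (w ++ Q') IQ _ _ ⟩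
    lookup (join (u ++ [ y ]) Q' Iw IQ') (posL (u ++ [ y ]) Q' _)     ≡⟨ lookup-join-posL (u ++ [ y ]) Q' _ IQ' _ ⟩
    lookup Iw (posR u [ y ] zero)                                       ≡⟨ lookup-join-posR u [ y ] Iu _ zero ⟩
    e                                                                   ∎
    where open ≡-Reasoning
          Iw = join u [ y ] Iu (e ∷ [])
  lookup-assemble IQ b Iu e IQ' (inQ' p) =
    trans (lookup-join-posR Q (w ++ Q') IQ _ _) (lookup-join-posR (u ++ [ y ]) Q' _ IQ' p)

  assemble-restrict : ∀ I → I ≡ assemble (tabulate (lookup I ∘ encode ∘ inQ)) (lookup I (encode first))
                                         (tabulate (lookup I ∘ encode ∘ inner)) (lookup I (encode last))
                                         (tabulate (lookup I ∘ encode ∘ inQ'))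
  assemble-restrict I = ≗-encode⇒≡ λ t → sym (trans (lookup-assemble _ _ _ _ _ t) (restrict t))
    where
    restrict : ∀ t → entry _ _ _ _ _ t ≡ lookup I (encode t)
    restrict (inQ p)   = lookup∘tabulate _ p
    restrict first     = refl
    restrict (inner p) = lookup∘tabulate _ p
    restrict last      = refl
    restrict (inQ' p)  = lookup∘tabulate _ p

relabel : ∀ {a b} → (Fin b → Fin a) → Subset a → Subset b
relabel ψ I = tabulate (lookup I ∘ ψ)

module _ {a b} {φ : Fin a → Fin b} {ψ : Fin b → Fin a} (ψ∘φ : ∀ v → ψ (φ v) ≡ v) where

  ∈-relabel : ∀ {I v} → v ∈ I → φ v ∈ relabel ψ I
  ∈-relabel {I} {v} v∈I =
    lookup⇒[]= (φ v) _ (trans (lookup∘tabulate _ (φ v)) (trans (cong (lookup I) (ψ∘φ v)) ([]=⇒lookup v∈I)))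

  isImage⇒≡relabel : (∀ t → φ (ψ t) ≡ t) → ∀ {I J} → IsImage φ I J → J ≡ relabel ψ I
  isImage⇒≡relabel φ∘ψ {I} {J} img = ≗-lookup⇒≡ λ t →
    trans (⇔→≡ (mk⇔ (image⇒ t) (⇒image t))) (sym (lookup∘tabulate _ t))
    where
    image⇒ : ∀ t → lookup J t ≡ true → lookup I (ψ t) ≡ true
    image⇒ t t∈J with proj₁ (img t) (lookup⇒[]= t J t∈J)
    ... | v , v∈I , refl = trans (cong (lookup I) (ψ∘φ v)) ([]=⇒lookup v∈I)
    ⇒image : ∀ t → lookup I (ψ t) ≡ true → lookup J t ≡ true
    ⇒image t ψt∈I = []=⇒lookup (subst (_∈ J) (φ∘ψ t) (proj₂ (img t) (ψ t) (lookup⇒[]= (ψ t) I ψt∈I)))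

isSimplicialIso-relabel : ∀ {a b} {K₁ : Subset a → Set} {K₂ : Subset b → Set}
  {φ : Fin a → Fin b} {ψ : Fin b → Fin a} → (∀ v → ψ (φ v) ≡ v) → (∀ t → φ (ψ t) ≡ t) →
  (∀ I → K₁ I → K₂ (relabel ψ I)) → (∀ J → K₂ J → K₁ (relabel φ J)) → IsSimplicialIso K₁ K₂ φ
isSimplicialIso-relabel {K₁ = K₁} {K₂} {φ} {ψ} ψ∘φ φ∘ψ K₁⇒K₂ K₂⇒K₁ =
  ψ , (λ v (I , I∈K₁ , v∈I) → (relabel ψ I , K₁⇒K₂ I I∈K₁ , ∈-relabel ψ∘φ v∈I) , ψ∘φ v)
    , (λ t (J , J∈K₂ , t∈J) → (relabel φ J , K₂⇒K₁ J J∈K₂ , ∈-relabel φ∘ψ t∈J) , φ∘ψ t)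
    , (λ I J I∈K₁ img → subst K₂ (sym (isImage⇒≡relabel ψ∘φ φ∘ψ img)) (K₁⇒K₂ I I∈K₁))
    , (λ J I J∈K₂ img → subst K₁ (sym (isImage⇒≡relabel φ∘ψ ψ∘φ img)) (K₂⇒K₁ J J∈K₂))

module ComplementWords {n : ℕ} (M : CoxeterMatrix n) where
  open Coxeter M
  open CoxeterWords M
  open Concatenation

  kept : Bool → Fin n → Word
  kept true  s = []
  kept false s = [ s ]

  complementWord-∷ : ∀ s U b I → complementWord (s ∷ U) (b ∷ I) ≡ kept b s ++ complementWord U I
  complementWord-∷ s U true  I = refl
  complementWord-∷ s U false I = refl

  complementWord-[] : ∀ s e → complementWord [ s ] (e ∷ []) ≡ kept e s
  complementWord-[] s true  = refl
  complementWord-[] s false = refl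

  complementWord-join : ∀ U V I J →
    complementWord (U ++ V) (join U V I J) ≡ complementWord U I ++ complementWord V J
  complementWord-join []      V []          J = refl
  complementWord-join (s ∷ U) V (true  ∷ I) J = complementWord-join U V I J
  complementWord-join (s ∷ U) V (false ∷ I) J = cong (s ∷_) (complementWord-join U V I J)

  complementWord-∅ : ∀ U → complementWord U ∅ ≡ U
  complementWord-∅ []      = refl
  complementWord-∅ (s ∷ U) = cong (s ∷_) (complementWord-∅ U)

  containsReduced-swapEnds : ∀ {x₁ u₁ y₁ x₂ u₂ y₂} →
    SubwordsCovered (x₁ ∷ (u₁ ++ [ y₁ ])) (x₂ ∷ (u₂ ++ [ y₂ ])) →
    u₁ ++ [ y₁ ] ≡ x₂ ∷ u₂ → x₁ ∷ u₁ ≡ u₂ ++ [ y₂ ] →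
    ∀ A B {π} b e → ¬ (b ≡ true × e ≡ true) →
    ContainsReduced (A ++ (kept b x₁ ++ ((u₁ ++ kept e y₁) ++ B))) π →
    ContainsReduced (A ++ (kept e x₂ ++ ((u₂ ++ kept b y₂) ++ B))) π
  containsReduced-swapEnds cover tail≡init init≡tail A B true  true  ¬both = ⊥-elim (¬both (refl , refl))
  containsReduced-swapEnds cover tail≡init init≡tail A B false false ¬both = containsReduced-replace cover A B
  containsReduced-swapEnds {u₂ = u₂} cover tail≡init init≡tail A B {π} true false ¬both =
    subst (λ v → ContainsReduced (A ++ (v ++ B)) π) (trans tail≡init (cong (_ ∷_) (sym (++-identityʳ u₂))))
  containsReduced-swapEnds {u₁ = u₁} cover tail≡init init≡tail A B {π} false true ¬both =
    subst (λ v → ContainsReduced (A ++ (v ++ B)) π) (trans (cong (_ ∷_) (++-identityʳ u₁)) init≡tail)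

module TildeFaces {n : ℕ} (M : CoxeterMatrix n) (Q Q' π : List (Fin n))
                  (x : Fin n) (u : List (Fin n)) (y : Fin n) (m : ℕ) (m≡ : m ≡ suc (suc (length u))) where
  open Coxeter M
  open ComplementWords M
  open Concatenation
  open Layout Q Q' x u y

  Complement : Subset (length Q) → Bool → Bool → Subset (length Q') → Word
  Complement IQ b e IQ' = complementWord Q IQ ++ (kept b x ++ ((u ++ kept e y) ++ complementWord Q' IQ'))

  complementWord-assemble : ∀ IQ b e IQ' →
    complementWord (Q ++ (w ++ Q')) (assemble IQ b ∅ e IQ') ≡ Complement IQ b e IQ'
  complementWord-assemble IQ b e IQ' = begin
    complementWord (Q ++ (w ++ Q')) (assemble IQ b ∅ e IQ')
      ≡⟨ complementWord-join Q (w ++ Q') IQ _ ⟩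
    cQ ++ complementWord (w ++ Q') (b ∷ join (u ++ [ y ]) Q' Iw IQ')
      ≡⟨ cong (cQ ++_) (complementWord-∷ x _ b _) ⟩
    cQ ++ (kept b x ++ complementWord ((u ++ [ y ]) ++ Q') (join (u ++ [ y ]) Q' Iw IQ'))
      ≡⟨ cong (λ v → cQ ++ (kept b x ++ v)) (complementWord-join (u ++ [ y ]) Q' Iw IQ') ⟩
    cQ ++ (kept b x ++ (complementWord (u ++ [ y ]) Iw ++ cQ'))
      ≡⟨ cong (λ v → cQ ++ (kept b x ++ (v ++ cQ'))) (complementWord-join u [ y ] ∅ (e ∷ [])) ⟩
    cQ ++ (kept b x ++ ((complementWord u ∅ ++ complementWord [ y ] (e ∷ [])) ++ cQ'))
      ≡⟨ cong₂ (λ v v' → cQ ++ (kept b x ++ ((v ++ v') ++ cQ'))) (complementWord-∅ u) (complementWord-[] y e) ⟩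
    Complement IQ b e IQ' ∎
    where
    open ≡-Reasoning
    cQ  = complementWord Q IQ
    cQ' = complementWord Q' IQ'
    Iw  = join u [ y ] ∅ (e ∷ [])

  toℕ-lastIndex : suc (toℕ lastIndex) ≡ m
  toℕ-lastIndex =
    trans (cong (λ k → suc (suc k)) (trans (toℕ-posR u [ y ] zero) (+-identityʳ (length u)))) (sym m≡)

  isLast⇒≡lastIndex : ∀ l → suc (toℕ l) ≡ m → l ≡ lastIndex
  isLast⇒≡lastIndex l l-last = toℕ-injective (suc-injective (trans l-last (sym toℕ-lastIndex)))

  Face : Subset N → Set
  Face = TildeFace M Q w Q' m π

  face⇒inner≡∅ : ∀ {IQ b Iu e IQ'} → Face (assemble IQ b Iu e IQ') → Iu ≡ ∅
  face⇒inner≡∅ {IQ} {b} {Iu} {e} {IQ'} (_ , noInternal , _) =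
    ≗-lookup⇒≡ λ p → trans (notInside p) (sym (lookup-replicate p false))
    where
    internal : ∀ p → suc (toℕ (suc (posL u [ y ] p))) < m
    internal p rewrite toℕ-posL u [ y ] p | m≡ = s≤s (s≤s (toℕ<n p))
    notInside : ∀ p → lookup Iu p ≡ false
    notInside p with lookup Iu p in p∈Iu
    ... | false = refl
    ... | true  = ⊥-elim (noInternal _ (s≤s z≤n) (internal p)
                    (lookup⇒[]= (encode (inner p)) _ (trans (lookup-assemble IQ b Iu e IQ' (inner p)) p∈Iu)))

  face⇒¬bothEnds : ∀ {IQ b Iu e IQ'} → Face (assemble IQ b Iu e IQ') → ¬ (b ≡ true × e ≡ true)
  face⇒¬bothEnds {IQ} {b} {Iu} {e} {IQ'} (_ , _ , notBoth) (b≡true , e≡true) =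
    notBoth (zero , lastIndex , refl , toℕ-lastIndex , inside first b≡true , inside last e≡true)
    where
    inside : ∀ t → entry IQ b Iu e IQ' t ≡ true → encode t ∈ assemble IQ b Iu e IQ'
    inside t t∈ = lookup⇒[]= (encode t) _ (trans (lookup-assemble IQ b Iu e IQ' t) t∈)

  face⇒containsReduced : ∀ {IQ b e IQ'} → Face (assemble IQ b ∅ e IQ') →
                         ContainsReduced (Complement IQ b e IQ') π
  face⇒containsReduced {IQ} {b} {e} {IQ'} (reduced , _) =
    subst (λ v → ContainsReduced v π) (complementWord-assemble IQ b e IQ') reduced

  endsFace : ∀ {IQ b e IQ'} → ¬ (b ≡ true × e ≡ true) → ContainsReduced (Complement IQ b e IQ') π →
             Face (assemble IQ b ∅ e IQ')
  endsFace {IQ} {b} {e} {IQ'} ¬both reduced =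
    subst (λ v → ContainsReduced v π) (sym (complementWord-assemble IQ b e IQ')) reduced , noInternal , notBoth
    where
    I = assemble IQ b ∅ e IQ'
    entry≡ : ∀ t → encode t ∈ I → entry IQ b ∅ e IQ' t ≡ true
    entry≡ t t∈I = trans (sym (lookup-assemble IQ b ∅ e IQ' t)) ([]=⇒lookup t∈I)
    noInternal : ∀ l → 0 < toℕ l → suc (toℕ l) < m → posMid Q w Q' l ∉ I
    noInternal l pos bound with middleView l
    noInternal _ () bound | at-first
    ... | at-inner p = λ p∈I →
      not-¬ {false} refl (trans (sym (lookup-replicate p false)) (entry≡ (inner p) p∈I))
    ... | at-last    = λ _ → <-irrefl toℕ-lastIndex bound
    notBoth : ¬ (∃ λ l → ∃ λ l' → toℕ l ≡ 0 × suc (toℕ l') ≡ m ×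
                                  posMid Q w Q' l ∈ I × posMid Q w Q' l' ∈ I)
    notBoth (zero , l' , _ , l'-last , first∈I , last∈I) rewrite isLast⇒≡lastIndex l' l'-last =
      ¬both (entry≡ first first∈I , entry≡ last last∈I)

EndSwappingIso : ∀ {n} → CoxeterMatrix n → (Q Q' π w₁ w₂ : List (Fin n)) → ℕ → Set
EndSwappingIso M Q Q' π w₁ w₂ m =
  ∃ λ (φ : Fin (length (Q ++ (w₁ ++ Q'))) → Fin (length (Q ++ (w₂ ++ Q')))) →
      IsSimplicialIso (TildeFace M Q w₁ Q' m π) (TildeFace M Q w₂ Q' m π) φ
    × (∀ p → φ (posQ Q w₁ Q' p) ≡ posQ Q w₂ Q' p)
    × (∀ p → φ (posQ' Q w₁ Q' p) ≡ posQ' Q w₂ Q' p)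
    × (∀ (l : Fin (length w₁)) (l' : Fin (length w₂)) → toℕ l ≡ 0 → suc (toℕ l') ≡ m →
         φ (posMid Q w₁ Q' l) ≡ posMid Q w₂ Q' l')
    × (∀ (l : Fin (length w₁)) (l' : Fin (length w₂)) → suc (toℕ l) ≡ m → toℕ l' ≡ 0 →
         φ (posMid Q w₁ Q' l) ≡ posMid Q w₂ Q' l')

module EndSwap {n : ℕ} (M : CoxeterMatrix n) (Q Q' π : List (Fin n))
  {x₁ y₁ x₂ y₂ : Fin n} {u₁ u₂ : List (Fin n)} {m : ℕ}
  (m≡₁ : m ≡ suc (suc (length u₁))) (m≡₂ : m ≡ suc (suc (length u₂)))
  (tail≡init : u₁ ++ [ y₁ ] ≡ x₂ ∷ u₂) (init≡tail : x₁ ∷ u₁ ≡ u₂ ++ [ y₂ ])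
  (cover : CoxeterWords.SubwordsCovered M (x₁ ∷ (u₁ ++ [ y₁ ])) (x₂ ∷ (u₂ ++ [ y₂ ])))
  where
  open Coxeter M using (complementWord)
  open ComplementWords M using (containsReduced-swapEnds)
  module L₁ = Layout Q Q' x₁ u₁ y₁
  module L₂ = Layout Q Q' x₂ u₂ y₂
  module T₁ = TildeFaces M Q Q' π x₁ u₁ y₁ m m≡₁
  module T₂ = TildeFaces M Q Q' π x₂ u₂ y₂ m m≡₂

  |u₁|≡|u₂| : length u₁ ≡ length u₂
  |u₁|≡|u₂| = suc-injective (suc-injective (trans (sym m≡₁) m≡₂))

  φ : Fin L₁.N → Fin L₂.N
  φ = L₂.encode ∘ swapEnds |u₁|≡|u₂| ∘ L₁.decode

  ψ : Fin L₂.N → Fin L₁.N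
  ψ = L₁.encode ∘ swapEnds (sym |u₁|≡|u₂|) ∘ L₂.decode

  φ-encode : ∀ t → φ (L₁.encode t) ≡ L₂.encode (swapEnds |u₁|≡|u₂| t)
  φ-encode t = cong (L₂.encode ∘ swapEnds _) (L₁.decode-encode t)

  ψ-encode : ∀ t → ψ (L₂.encode t) ≡ L₁.encode (swapEnds (sym |u₁|≡|u₂|) t)
  ψ-encode t = cong (L₁.encode ∘ swapEnds _) (L₂.decode-encode t)

  ψ∘φ : ∀ v → ψ (φ v) ≡ v
  ψ∘φ v = begin
    ψ (φ v)                                          ≡⟨ ψ-encode (swapEnds _ (L₁.decode v)) ⟩
    L₁.encode (swapEnds _ (swapEnds _ (L₁.decode v))) ≡⟨ cong L₁.encode (swapEnds-involutive _ _ (L₁.decode v)) ⟩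
    L₁.encode (L₁.decode v)                          ≡⟨ L₁.encode-decode v ⟩
    v                                                ∎
    where open ≡-Reasoning

  φ∘ψ : ∀ t → φ (ψ t) ≡ t
  φ∘ψ t = begin
    φ (ψ t)                                          ≡⟨ φ-encode (swapEnds _ (L₂.decode t)) ⟩
    L₂.encode (swapEnds _ (swapEnds _ (L₂.decode t))) ≡⟨ cong L₂.encode (swapEnds-involutive _ _ (L₂.decode t)) ⟩
    L₂.encode (L₂.decode t)                          ≡⟨ L₂.encode-decode t ⟩
    t                                                ∎
    where open ≡-Reasoning

  relabel-assemble : ∀ IQ b e IQ' → relabel ψ (L₁.assemble IQ b ∅ e IQ') ≡ L₂.assemble IQ e ∅ b IQ'
  relabel-assemble IQ b e IQ' = L₂.≗-encode⇒≡ λ t → begin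
    lookup (relabel ψ I) (L₂.encode t)       ≡⟨ lookup∘tabulate _ (L₂.encode t) ⟩
    lookup I (ψ (L₂.encode t))               ≡⟨ cong (lookup I) (ψ-encode t) ⟩
    lookup I (L₁.encode (swapEnds _ t))      ≡⟨ L₁.lookup-assemble IQ b ∅ e IQ' (swapEnds _ t) ⟩
    entry IQ b ∅ e IQ' (swapEnds _ t)        ≡⟨ entry-swapEnds _ IQ b e IQ' t ⟩
    entry IQ e ∅ b IQ' t                     ≡⟨ L₂.lookup-assemble IQ e ∅ b IQ' t ⟨
    lookup (L₂.assemble IQ e ∅ b IQ') (L₂.encode t) ∎
    where
    open ≡-Reasoning
    I = L₁.assemble IQ b ∅ e IQ'

  face-relabel : ∀ I → T₁.Face I → T₂.Face (relabel ψ I)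
  face-relabel I I∈K₁ = subst (T₂.Face ∘ relabel ψ) (sym I≡) (assembled (subst T₁.Face I≡ I∈K₁))
    where
    I≡ = L₁.assemble-restrict I
    assembled : ∀ {IQ b Iu e IQ'} → T₁.Face (L₁.assemble IQ b Iu e IQ') →
                T₂.Face (relabel ψ (L₁.assemble IQ b Iu e IQ'))
    assembled {IQ} {b} {Iu} {e} {IQ'} face with T₁.face⇒inner≡∅ face
    ... | refl = subst T₂.Face (sym (relabel-assemble IQ b e IQ')) (T₂.endsFace (¬both ∘ Product.swap)
                   (containsReduced-swapEnds cover tail≡init init≡tail (complementWord Q IQ) (complementWord Q' IQ')
                      b e ¬both (T₁.face⇒containsReduced face)))
      where ¬both = T₁.face⇒¬bothEnds face

  first↦last : ∀ l l' → toℕ l ≡ 0 → suc (toℕ l') ≡ m → φ (posMid Q L₁.w Q' l) ≡ posMid Q L₂.w Q' l'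
  first↦last zero    l' _  l'-last rewrite T₂.isLast⇒≡lastIndex l' l'-last = φ-encode first
  first↦last (suc l) l' () _

  last↦first : ∀ l l' → suc (toℕ l) ≡ m → toℕ l' ≡ 0 → φ (posMid Q L₁.w Q' l) ≡ posMid Q L₂.w Q' l'
  last↦first l zero     l-last _ rewrite T₁.isLast⇒≡lastIndex l l-last = φ-encode last
  last↦first l (suc l') _      ()

endSwappingIso : ∀ {n} (M : CoxeterMatrix n) (Q Q' π : List (Fin n))
  {x₁ y₁ x₂ y₂ : Fin n} {u₁ u₂ : List (Fin n)} {m : ℕ} →
  m ≡ suc (suc (length u₁)) → m ≡ suc (suc (length u₂)) →
  u₁ ++ [ y₁ ] ≡ x₂ ∷ u₂ → x₁ ∷ u₁ ≡ u₂ ++ [ y₂ ] →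
  CoxeterWords.SubwordsCovered M (x₁ ∷ (u₁ ++ [ y₁ ])) (x₂ ∷ (u₂ ++ [ y₂ ])) →
  CoxeterWords.SubwordsCovered M (x₂ ∷ (u₂ ++ [ y₂ ])) (x₁ ∷ (u₁ ++ [ y₁ ])) →
  EndSwappingIso M Q Q' π (x₁ ∷ (u₁ ++ [ y₁ ])) (x₂ ∷ (u₂ ++ [ y₂ ])) m
endSwappingIso M Q Q' π m≡₁ m≡₂ tail≡init init≡tail cover₁₂ cover₂₁ =
  F.φ , isSimplicialIso-relabel F.ψ∘φ F.φ∘ψ F.face-relabel R.face-relabel ,
  F.φ-encode ∘ inQ , F.φ-encode ∘ inQ' , F.first↦last , F.last↦first
  where
  module F = EndSwap M Q Q' π m≡₁ m≡₂ tail≡init init≡tail cover₁₂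
  module R = EndSwap M Q Q' π m≡₂ m≡₁ (sym init≡tail) (sym tail≡init) cover₂₁

module _ {n : ℕ} (M : CoxeterMatrix n) where
  open Coxeter M
  open CoxeterWords M

  braid⇒endSwappingIso : ∀ i j {k} → 2 ≤ k → alt i j k ∼ alt j i k → ∀ Q Q' π →
                         EndSwappingIso M Q Q' π (alt i j k) (alt j i k) k
  braid⇒endSwappingIso i j {suc (suc k)} (s≤s (s≤s _)) braid-ij Q Q' π =
    subst₂ (λ w₁ w₂ → EndSwappingIso M Q Q' π w₁ w₂ (suc (suc k))) (sym w₁≡) (sym w₂≡)
      (endSwappingIso M Q Q' π
        (cong (λ l → suc (suc l)) (sym (length-alt j i k))) (cong (λ l → suc (suc l)) (sym (length-alt i j k)))
        (sym (alt-snoc j i k)) (alt-snoc i j k)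
        (subst₂ SubwordsCovered w₁≡ w₂≡ (alt-subwordsCovered i j _ braid-ij))
        (subst₂ SubwordsCovered w₂≡ w₁≡ (alt-subwordsCovered j i _ (∼-sym braid-ij))))
    where
    w₁≡ = cong (i ∷_) (alt-snoc j i k)
    w₂≡ = cong (j ∷_) (alt-snoc i j k)

mainTheorem5 : ∀ {n : ℕ} (M : CoxeterMatrix n) → Coxeter.FiniteW M →
  (i j : Fin n) → i ≢ j → (Q Q' π : List (Fin n)) →
  let m = CoxeterMatrix.m M i j
      w₁ = Coxeter.alt M i j m
      w₂ = Coxeter.alt M j i m
  in ∃ λ (φ : Fin (length (Q ++ (w₁ ++ Q'))) → Fin (length (Q ++ (w₂ ++ Q')))) →
       IsSimplicialIso (TildeFace M Q w₁ Q' m π) (TildeFace M Q w₂ Q' m π) φ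
     × (∀ p → φ (posQ Q w₁ Q' p) ≡ posQ Q w₂ Q' p)
     × (∀ p → φ (posQ' Q w₁ Q' p) ≡ posQ' Q w₂ Q' p)
     × (∀ (l : Fin (length w₁)) (l' : Fin (length w₂)) → toℕ l ≡ 0 → suc (toℕ l') ≡ m →
          φ (posMid Q w₁ Q' l) ≡ posMid Q w₂ Q' l')
     × (∀ (l : Fin (length w₁)) (l' : Fin (length w₂)) → suc (toℕ l) ≡ m → toℕ l' ≡ 0 →
          φ (posMid Q w₁ Q' l) ≡ posMid Q w₂ Q' l')
mainTheorem5 M _ i j i≢j =
  braid⇒endSwappingIso M i j (CoxeterMatrix.m-off M i j i≢j) (CoxeterWords.braid M i j)
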